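{- For every countable ordinal $\alpha$ and all $x,y\in X^{\alpha}$: $x\,\Delta^{\alpha}\,y\in\mathrm{I}^{\alpha}$ if and only if there is a path of length $2$ from $x$ to $y$ in $K_2^{\alpha}$.
   Context: For each countable limit ordinal $\lambda$ fix an increasing cofinal $\pi_\lambda\colon\omega\to\lambda$; for successor $\alpha+1$ let $\pi_{\alpha+1}$ be constantly $\alpha$. For graphs $G_i$ on $X_i$, $(G_i)^{*}$ is the graph on $\prod_iX_i$ with $x\mathrel{(G_i)^{*}}y$ iff $\exists n\,\forall m>n\;x(m)\mathrel{G_m}y(m)$. For a graph $G$, $G^0=G$ and $G^\alpha=(G^{\pi_\alpha(n)})^{*}_{n\in\omega}$ for $\alpha>0$. $K_2$ is the complete graph on $\{0,1\}$. Let $X^0=\{0,1\}$ and $X^\alpha=\prod_n X^{\pi_\alpha(n)}$ for $\alpha>0$, so $K_2^\alpha$ is a graph on $X^\alpha$. Iterated Fréchet filters and ideals: $\mathrm{F}^0=\{1\}$, $\mathrm{I}^0=\{0\}$, and for $\alpha>0$, $\mathrm{F}^\alpha=\{x\in X^\alpha:\exists n\,\forall m>n\; x(m)\in\mathrm{F}^{\pi_\alpha(m)}\}$, $\mathrm{I}^\alpha=\{x\in X^\alpha:\exists n\,\forall m>n\; x(m)\in\mathrm{I}^{\pi_\alpha(m)}\}$. The operation $\Delta^\alpha$ on $X^\alpha$: $x\,\Delta^0\,y=0$ if $x=y$ and $=1$ otherwise; for $\alpha>0$, $(x\,\Delta^\alpha\,y)(n)=x(n)\,\Delta^{\pi_\alpha(n)}\,y(n)$.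 -}

module Defs where

open import Data.Nat using (ℕ; _<_) renaming (suc to sucℕ)
open import Data.Bool using (Bool; true; false; _xor_)
open import Data.Product using (Σ; ∃; _×_)
open import Data.Product using (_,_)
open import Relation.Binary.PropositionalEquality using (_≡_; _≢_)

-- Countable ordinals as Brouwer trees.  A limit node `lim f` carries its
-- fixed cofinal sequence π_λ = f; a successor `suc a` has π constantly a.
data Ord : Set where
  zero : Ord
  suc  : Ord → Ord
  lim  : (ℕ → Ord) → Ord

data _≤ₒ_ : Ord → Ord → Set where
  ≤-zero     : ∀ {b} → zero ≤ₒ b
  ≤-trans    : ∀ {a b c} → a ≤ₒ b → b ≤ₒ c → a ≤ₒ c
  ≤-suc-mono : ∀ {a b} → a ≤ₒ b → suc a ≤ₒ suc b
  ≤-cocone   : ∀ {a f} k → a ≤ₒ f k → a ≤ₒ lim f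
  ≤-limiting : ∀ {f b} → (∀ k → f k ≤ₒ b) → lim f ≤ₒ b

_<ₒ_ : Ord → Ord → Set
a <ₒ b = suc a ≤ₒ b

-- Well-formed trees: every limit node carries a strictly increasing sequence
-- (it is then cofinal in the limit by construction).
data WF : Ord → Set where
  wf-zero : WF zero
  wf-suc  : ∀ {a} → WF a → WF (suc a)
  wf-lim  : ∀ {f} → (∀ n → WF (f n)) → (∀ n → f n <ₒ f (sucℕ n)) → WF (lim f)

Graph : Set → Set₁
Graph A = A → A → Set

star : {Xs : ℕ → Set} → ((n : ℕ) → Graph (Xs n)) → Graph ((n : ℕ) → Xs n)
star G x y = Σ ℕ λ n → ∀ m → n < m → G m (x m) (y m)

eventually : {Xs : ℕ → Set} → ((n : ℕ) → Xs n → Set) → ((n : ℕ) → Xs n) → Set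
eventually P x = Σ ℕ λ n → ∀ m → n < m → P m (x m)

-- X^α ; X^0 = {0,1} encoded as Bool (false = 0, true = 1)
X : Ord → Set
X zero    = Bool
X (suc a) = (n : ℕ) → X a
X (lim f) = (n : ℕ) → X (f n)

K₂ : Graph Bool
K₂ x y = x ≢ y

K₂^ : (α : Ord) → Graph (X α)
K₂^ zero    = K₂
K₂^ (suc a) = star {λ _ → X a} (λ _ → K₂^ a)
K₂^ (lim f) = star {λ n → X (f n)} (λ n → K₂^ (f n))

I : (α : Ord) → X α → Set
I zero    x = x ≡ false
I (suc a) x = eventually {λ _ → X a} (λ _ → I a) x
I (lim f) x = eventually {λ n → X (f n)} (λ n → I (f n)) x

Δ : (α : Ord) → X α → X α → X α
Δ zero    x y   = x xor y
Δ (suc a) x y n = Δ a (x n) (y n)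
Δ (lim f) x y n = Δ (f n) (x n) (y n)

Path2 : {A : Set} → Graph A → A → A → Set
Path2 {A} G x y = Σ A λ z → G x z × G z y

-- Unfolding the definitions, both sides at a successor or limit are "eventually, coordinatewise"
-- conditions: a length-2 path in a star graph yields coordinatewise length-2 paths eventually
-- (take the larger of the two thresholds), and conversely coordinatewise midpoints assemble
-- into a midpoint. At the base, x xor y = 0 iff x = y iff x, not x, y is a path in K₂.
module Submission where

open import Defs
open import Data.Bool using (Bool; true; false; not; _xor_)
open import Data.Bool.Properties using (not-¬; ¬-not)
open import Data.Nat using (ℕ; _<_; _<?_; _⊔_)
open import Data.Nat.Properties using (≤-<-trans; m≤m⊔n; m≤n⊔m)
open import Data.Product using (Σ; _×_; _,_; proj₁; proj₂)
open import Function.Bundles using (_⇔_; mk⇔; Equivalence)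
open import Function.Properties.Equivalence using () renaming (sym to ⇔-sym; trans to ⇔-trans)
open import Relation.Nullary using (Dec; yes; no; contradiction)
open import Relation.Binary.PropositionalEquality using (_≡_; refl; sym; trans; ≢-sym)

xor≡false⇔≡ : (x y : Bool) → x xor y ≡ false ⇔ x ≡ y
xor≡false⇔≡ false false = mk⇔ (λ _ → refl) (λ _ → refl)
xor≡false⇔≡ true  true  = mk⇔ (λ _ → refl) (λ _ → refl)
xor≡false⇔≡ false true  = mk⇔ (λ ()) (λ ())
xor≡false⇔≡ true  false = mk⇔ (λ ()) (λ ())

Path2-K₂⇔≡ : {x y : Bool} → Path2 K₂ x y ⇔ x ≡ y
Path2-K₂⇔≡ = mk⇔ to from
  where
  to : ∀ {x y} → Path2 K₂ x y → x ≡ y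
  to (z , x≢z , z≢y) = trans (¬-not x≢z) (sym (¬-not (≢-sym z≢y)))
  from : ∀ {x y} → x ≡ y → Path2 K₂ x y
  from {x} refl = not x , not-¬ refl , ≢-sym (not-¬ refl)

Eventually : (ℕ → Set) → Set
Eventually P = Σ ℕ λ n → ∀ m → n < m → P m

Eventually-map : {P Q : ℕ → Set} → (∀ m → P m → Q m) → Eventually P → Eventually Q
Eventually-map f (n , h) = n , λ m n<m → f m (h m n<m)

Eventually-cong : {P Q : ℕ → Set} → (∀ m → P m ⇔ Q m) → Eventually P ⇔ Eventually Q
Eventually-cong P⇔Q = mk⇔ (Eventually-map (λ m → Equivalence.to (P⇔Q m)))
                          (Eventually-map (λ m → Equivalence.from (P⇔Q m)))

Eventually-× : {P Q : ℕ → Set} → Eventually P → Eventually Q → Eventually (λ m → P m × Q m)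
Eventually-× (n₁ , h₁) (n₂ , h₂) = n₁ ⊔ n₂ , λ m n<m →
  h₁ m (≤-<-trans (m≤m⊔n n₁ n₂) n<m) , h₂ m (≤-<-trans (m≤n⊔m n₁ n₂) n<m)

module _ {Xs : ℕ → Set} (G : ∀ n → Graph (Xs n)) {x y : (n : ℕ) → Xs n} where

  Path2-star⇔Eventually-Path2 : Path2 (star G) x y ⇔ Eventually (λ m → Path2 (G m) (x m) (y m))
  Path2-star⇔Eventually-Path2 = mk⇔ to from
    where
    to : Path2 (star G) x y → Eventually (λ m → Path2 (G m) (x m) (y m))
    to (z , xz , zy) = Eventually-map (λ m (p , q) → z m , p , q) (Eventually-× xz zy)

    from : Eventually (λ m → Path2 (G m) (x m) (y m)) → Path2 (star G) x y
    from (n , path) = z , (n , x~z) , (n , z~y)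
      where
      -- Below the threshold the midpoint is irrelevant, so it is padded with x.
      midpoint : ∀ m → Dec (n < m) → Xs m
      midpoint m (yes n<m) = proj₁ (path m n<m)
      midpoint m (no _)    = x m

      z : (m : ℕ) → Xs m
      z m = midpoint m (n <? m)

      x~z : ∀ m → n < m → G m (x m) (z m)
      x~z m n<m with n <? m
      ... | yes n<m′ = proj₁ (proj₂ (path m n<m′))
      ... | no  n≮m  = contradiction n<m n≮m

      z~y : ∀ m → n < m → G m (z m) (y m)
      z~y m n<m with n <? m
      ... | yes n<m′ = proj₂ (proj₂ (path m n<m′))
      ... | no  n≮m  = contradiction n<m n≮m

Δ∈I⇔Path2 : (α : Ord) (x y : X α) → I α (Δ α x y) ⇔ Path2 (K₂^ α) x y
Δ∈I⇔Path2 zero    x y = ⇔-trans (xor≡false⇔≡ x y) (⇔-sym Path2-K₂⇔≡)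
Δ∈I⇔Path2 (suc α) x y =
  ⇔-trans (Eventually-cong λ m → Δ∈I⇔Path2 α (x m) (y m)) (⇔-sym (Path2-star⇔Eventually-Path2 λ _ → K₂^ α))
Δ∈I⇔Path2 (lim f) x y =
  ⇔-trans (Eventually-cong λ m → Δ∈I⇔Path2 (f m) (x m) (y m)) (⇔-sym (Path2-star⇔Eventually-Path2 λ m → K₂^ (f m)))

lemma3p7 : (α : Ord) → WF α → (x y : X α) →
    (I α (Δ α x y) → Path2 (K₂^ α) x y) × (Path2 (K₂^ α) x y → I α (Δ α x y))
lemma3p7 α _ x y = to , from
  where open Equivalence (Δ∈I⇔Path2 α x y)
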